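{- Let $c$ be a prime of the form $2^r\cdot 3+1$ ($r$ a positive integer), and let $a,b$ be integers greater than $1$ such that $a,b,c$ are pairwise relatively prime and $e_c(a)=e_c(b)=3$. Let $z,Y,Z$ be positive integers with $z\le Z$, $Y\equiv 4\pmod 6$, $a+b=c^z$ and $a+b^Y=c^Z$; write $Y=1+3N$ and $e=\nu_c(N)$. Then $Z\ge 2z-2e$.
   Context: For a positive integer $M$ and an integer $A$ coprime to $M$, $e_M(A)$ is the least positive integer $e$ such that $A^e\equiv\pm1\pmod M$. $\nu_c(N)$ is the exponent of the prime $c$ in $N$. -}

module Defs where

open import Data.Nat using (ℕ; zero; suc; _+_; _*_; _∸_; _^_; _≤_; _<_)
open import Data.Nat.DivMod using (_%_; _mod_)
open import Data.Nat.Divisibility using (_∣_)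
open import Data.Product using (_×_)
open import Data.Sum using (_⊎_)
open import Relation.Binary.PropositionalEquality using (_≡_)
open import Relation.Nullary using (¬_)

-- A ≡ ±1 (mod M), for M ≥ 1 (stated via the remainder mod M, M = suc m).
PlusMinusOne : (m : ℕ) → ℕ → Set
PlusMinusOne m x = (x % suc m ≡ 1 % suc m) ⊎ (x % suc m ≡ m)

IsEOrder : (m : ℕ) → (A e : ℕ) → Set
IsEOrder m A e =
  (0 < e) × PlusMinusOne m (A ^ e) × (∀ d → 0 < d → d < e → ¬ PlusMinusOne m (A ^ d))

IsVal : (c N k : ℕ) → Set
IsVal c N k = (c ^ k ∣ N) × ¬ (c ^ suc k ∣ N)

-- Since a + b = c^z and a + b^Y = c^Z with Y = 1 + 3N, c^z divides b(b^{3N} - 1), hence b^{3N} - 1.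
-- As N is odd, b^3 ≡ -1 (mod c) would force b^{3N} ≡ -1, so b^3 ≡ 1 (mod c). Lifting the exponent
-- along N = m c^e with c ∤ m gives c^{z-e} | b^3 - 1 = (b - 1)(1 + b + b^2), and c ∤ b - 1 since
-- e_c(b) = 3. Hence c^{z-e} ≤ 1 + b + b^2 ≤ 2b^2, and c^{2(z-e)} ≤ 4b^4 < c b^Y < c^{Z+1}.

module Submission where

open import Defs
open import Data.Nat using (ℕ; zero; suc; _+_; _*_; _∸_; _^_; _≤_; _<_; NonZero; >-nonZero; z≤n; s≤s; s≤s⁻¹; nonTrivial⇒≢1)
open import Data.Nat.DivMod using (_%_; _/_; m≡m%n+[m/n]*n; %-remove-+ʳ)
open import Data.Nat.Primality using (Prime; euclidsLemma; prime⇒nonZero; prime⇒nonTrivial)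
open import Data.Nat.Coprimality using (Coprime)
open import Data.Nat.Properties
open import Data.Nat.Divisibility
open import Data.Nat.Tactic.RingSolver using (solve-∀)
open import Data.Product using (_×_; _,_; ∃-syntax)
open import Data.Sum using (inj₁; inj₂)
open import Relation.Nullary using (¬_; contradiction)
open import Relation.Binary.PropositionalEquality
open import Function using (_∘_)

-- geom d m = Σ_{i<m} (1 + d)^i. Lifting the exponent rests on (1 + d)^m - 1 = d · geom d m,
-- geom d m ≡ m (mod d), and geom d c ≡ c (mod c^2) when c ∣ d is odd, since then c ∣ c(c-1)/2.
geom : ℕ → ℕ → ℕ
geom d zero    = 0
geom d (suc m) = 1 + (1 + d) * geom d m

triangle : ℕ → ℕ
triangle zero    = 0
triangle (suc m) = triangle m + m

suc^≡1+*geom : ∀ d m → (1 + d) ^ m ≡ 1 + d * geom d m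
suc^≡1+*geom d zero    = cong suc (sym (*-zeroʳ d))
suc^≡1+*geom d (suc m) = begin
  (1 + d) * (1 + d) ^ m       ≡⟨ cong ((1 + d) *_) (suc^≡1+*geom d m) ⟩
  (1 + d) * (1 + d * geom d m) ≡⟨ expand d (geom d m) ⟩
  1 + d * geom d (suc m)      ∎
  where
  open ≡-Reasoning
  expand : ∀ d g → (1 + d) * (1 + d * g) ≡ 1 + d * (1 + (1 + d) * g)
  expand = solve-∀

suc^[m*n]≡suc-geom^m : ∀ d m n → (1 + d) ^ (m * n) ≡ (1 + d * geom d n) ^ m
suc^[m*n]≡suc-geom^m d m n = begin
  (1 + d) ^ (m * n)       ≡⟨ cong ((1 + d) ^_) (*-comm m n) ⟩
  (1 + d) ^ (n * m)       ≡⟨ ^-*-assoc (1 + d) n m ⟨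
  ((1 + d) ^ n) ^ m       ≡⟨ cong (_^ m) (suc^≡1+*geom d n) ⟩
  (1 + d * geom d n) ^ m  ∎
  where open ≡-Reasoning

suc^∸1≡*geom : ∀ d m → (1 + d) ^ m ∸ 1 ≡ d * geom d m
suc^∸1≡*geom d m = cong (_∸ 1) (suc^≡1+*geom d m)

geom-expansion : ∀ d m → ∃[ k ] geom d m ≡ m + d * triangle m + d * d * k
geom-expansion d zero    = 0 , base d
  where
  base : ∀ d → 0 ≡ 0 + d * 0 + d * d * 0
  base = solve-∀
geom-expansion d (suc m) with geom-expansion d m
... | k , eq = triangle m + k + d * k , (begin
  1 + (1 + d) * geom d m                                ≡⟨ cong (λ g → 1 + (1 + d) * g) eq ⟩
  1 + (1 + d) * (m + d * triangle m + d * d * k)        ≡⟨ expand d m (triangle m) k ⟩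
  suc m + d * (triangle m + m) + d * d * (triangle m + k + d * k) ∎)
  where
  open ≡-Reasoning
  expand : ∀ d m t k → 1 + (1 + d) * (m + d * t + d * d * k)
                      ≡ suc m + d * (t + m) + d * d * (t + k + d * k)
  expand = solve-∀

triangle-odd : ∀ q → triangle (1 + 2 * q) ≡ q * (1 + 2 * q)
triangle-odd zero    = refl
triangle-odd (suc q) = begin
  triangle (1 + 2 * suc q)                          ≡⟨ cong triangle (cong suc (*-suc 2 q)) ⟩
  triangle (1 + 2 * q) + (1 + 2 * q) + (2 + 2 * q)  ≡⟨ cong (λ t → t + (1 + 2 * q) + (2 + 2 * q))
                                                           (triangle-odd q) ⟩
  q * (1 + 2 * q) + (1 + 2 * q) + (2 + 2 * q)       ≡⟨ expand q ⟩
  suc q * (1 + 2 * suc q)                           ∎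
  where
  open ≡-Reasoning
  expand : ∀ q → q * (1 + 2 * q) + (1 + 2 * q) + (2 + 2 * q) ≡ suc q * (1 + 2 * suc q)
  expand = solve-∀

prime∤1 : ∀ {p} → Prime p → ¬ p ∣ 1
prime∤1 p-prime p∣1 = nonTrivial⇒≢1 {{prime⇒nonTrivial p-prime}} (∣1⇒≡1 p∣1)

prime∤coprime : ∀ {b c} → Prime c → Coprime b c → ¬ c ∣ b
prime∤coprime {c = c} c-prime b⊥c c∣b = prime∤1 c-prime (subst (c ∣_) (b⊥c (c∣b , ∣-refl)) ∣-refl)

m∣m^n : ∀ {m n} → 1 ≤ n → m ∣ m ^ n
m∣m^n {m} {suc n} _ = m∣m*n (m ^ n)

prime-power-divisor : ∀ {p n} → Prime p → ¬ p ∣ n → ∀ k {m} → p ^ k ∣ n * m → p ^ k ∣ m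
prime-power-divisor p-prime p∤n zero    {m} _ = 1∣ m
prime-power-divisor {p} {n} p-prime p∤n (suc k) {m} p^[1+k]∣nm
  with euclidsLemma n m p-prime (m*n∣⇒m∣ p (p ^ k) p^[1+k]∣nm)
... | inj₁ p∣n = contradiction p∣n p∤n
... | inj₂ (divides j refl) = subst (p * p ^ k ∣_) (*-comm p j) (*-monoʳ-∣ p p^k∣j)
  where
  instance _ = prime⇒nonZero p-prime
  p^k∣j : p ^ k ∣ j
  p^k∣j = prime-power-divisor p-prime p∤n k
    (*-cancelˡ-∣ p (subst (p * p ^ k ∣_) (swap n j p) p^[1+k]∣nm))
    where
    swap : ∀ n j p → n * (j * p) ≡ p * (n * j)
    swap = solve-∀

%≡1%⇒∣∸1 : ∀ {x p} → x % suc p ≡ 1 % suc p → suc p ∣ x ∸ 1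
%≡1%⇒∣∸1 {x} {zero}  _     = 1∣ (x ∸ 1)
%≡1%⇒∣∸1 {x} {suc p} x%c≡1 =
  divides (x / c) (cong (_∸ 1) (trans (m≡m%n+[m/n]*n x c) (cong (_+ (x / c) * c) x%c≡1)))
  where c = suc (suc p)

∣∸1⇒%≡1% : ∀ {b c} .{{_ : NonZero c}} → 1 ≤ b → c ∣ b ∸ 1 → b % c ≡ 1 % c
∣∸1⇒%≡1% {suc b'} _ c∣b' = %-remove-+ʳ 1 c∣b'

%≡pred⇒∣+1 : ∀ {x p} → x % suc p ≡ p → suc p ∣ x + 1
%≡pred⇒∣+1 {x} {p} x%c≡p = divides (suc (x / suc p)) (begin
  x + 1                            ≡⟨ cong (_+ 1) (m≡m%n+[m/n]*n x (suc p)) ⟩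
  x % suc p + x / suc p * suc p + 1 ≡⟨ cong (λ r → r + x / suc p * suc p + 1) x%c≡p ⟩
  p + x / suc p * suc p + 1        ≡⟨ regroup p (x / suc p) ⟩
  suc (x / suc p) * suc p          ∎)
  where
  open ≡-Reasoning
  regroup : ∀ p k → p + k * suc p + 1 ≡ suc k * suc p
  regroup = solve-∀

∣+1⇒∣^odd+1 : ∀ {n x} t → n ∣ x + 1 → n ∣ x ^ (1 + 2 * t) + 1
∣+1⇒∣^odd+1 {n} {x} zero    n∣x+1 = subst (λ y → n ∣ y + 1) (sym (*-identityʳ x)) n∣x+1
∣+1⇒∣^odd+1 {n} {x} (suc t) n∣x+1 =
  ∣m+n∣m⇒∣n (subst (n ∣_) (sym regrouped) n∣rhs) (∣n⇒∣m*n x n∣x+1)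
  where
  y = x ^ (1 + 2 * t)
  n∣rhs : n ∣ x * x * (y + 1) + (x + 1)
  n∣rhs = ∣m∣n⇒∣m+n (∣n⇒∣m*n (x * x) (∣+1⇒∣^odd+1 t n∣x+1)) n∣x+1
  regrouped : x * (x + 1) + (x ^ (1 + 2 * suc t) + 1) ≡ x * x * (y + 1) + (x + 1)
  regrouped = begin
    x * (x + 1) + (x ^ (1 + 2 * suc t) + 1) ≡⟨ cong (λ k → x * (x + 1) + (x ^ (1 + k) + 1)) (*-suc 2 t) ⟩
    x * (x + 1) + (x * (x * y) + 1)          ≡⟨ identity x y ⟩
    x * x * (y + 1) + (x + 1)                ∎
    where
    open ≡-Reasoning
    identity : ∀ x y → x * (x + 1) + (x * (x * y) + 1) ≡ x * x * (y + 1) + (x + 1)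
    identity = solve-∀

∣+1∧∣∸1⇒∣2 : ∀ {n} u → n ∣ u + 1 → n ∣ u ∸ 1 → n ∣ 2
∣+1∧∣∸1⇒∣2     zero     n∣1   _    = ∣-trans n∣1 (1∣ 2)
∣+1∧∣∸1⇒∣2 {n} (suc u') n∣u+1 n∣u' = ∣m+n∣m⇒∣n (subst (n ∣_) (sym (+-suc u' 1)) n∣u+1) n∣u'

∣+1⇒∤^odd∸1 : ∀ {n x} t → 2 < n → n ∣ x + 1 → ¬ n ∣ x ^ (1 + 2 * t) ∸ 1
∣+1⇒∤^odd∸1 {x = x} t 2<n n∣x+1 n∣ =
  <⇒≱ 2<n (∣⇒≤ (∣+1∧∣∸1⇒∣2 (x ^ (1 + 2 * t)) (∣+1⇒∣^odd+1 t n∣x+1) n∣))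

∣geom⇒∣ : ∀ {c d} m → c ∣ d → c ∣ geom d m → c ∣ m
∣geom⇒∣ {c} {d} m c∣d c∣geom with geom-expansion d m
... | k , eq = ∣m+n∣m⇒∣n (subst (c ∣_) (trans eq (regroup m d (triangle m) k)) c∣geom)
                          (∣m⇒∣m*n (triangle m + d * k) c∣d)
  where
  regroup : ∀ m d t k → m + d * t + d * d * k ≡ d * (t + d * k) + m
  regroup = solve-∀

lte-coprime : ∀ {c d m} → Prime c → c ∣ d → ¬ c ∣ m → ∀ k → c ^ k ∣ (1 + d) ^ m ∸ 1 → c ^ k ∣ d
lte-coprime {c} {d} {m} c-prime c∣d c∤m k c^k∣ =
  prime-power-divisor c-prime (c∤m ∘ ∣geom⇒∣ m c∣d) k
    (subst (c ^ k ∣_) (trans (suc^∸1≡*geom d m) (*-comm d (geom d m))) c^k∣)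

cube∸1 : ∀ b → b ^ 3 ∸ 1 ≡ (b ∸ 1) * (1 + b + b * b)
cube∸1 zero     = refl
cube∸1 (suc b') = cong (_∸ 1) (expand b')
  where
  expand : ∀ b' → suc b' * (suc b' * (suc b' * 1)) ≡ 1 + b' * (1 + suc b' + suc b' * suc b')
  expand = solve-∀

IsEOrder⇒≢1 : ∀ {p b e} → 1 < e → IsEOrder p b e → ¬ b % suc p ≡ 1 % suc p
IsEOrder⇒≢1 {p} {b} 1<e (_ , _ , minimal) =
  minimal 1 (s≤s z≤n) 1<e ∘ inj₁ ∘ subst (λ x → x % suc p ≡ 1 % suc p) (sym (*-identityʳ b))

IsVal⇒cofactor : ∀ {c N e} → IsVal c N e → ∃[ m ] N ≡ m * c ^ e × ¬ c ∣ m
IsVal⇒cofactor {c} {N} {e} (c^e∣N , c^[1+e]∤N) = quotient c^e∣N , m∣n⇒n≡quotient*m c^e∣N , c∤m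
  where
  c∤m : ¬ c ∣ quotient c^e∣N
  c∤m (divides j m≡jc) = c^[1+e]∤N (divides j (begin
    N                        ≡⟨ m∣n⇒n≡quotient*m c^e∣N ⟩
    quotient c^e∣N * c ^ e   ≡⟨ cong (_* c ^ e) m≡jc ⟩
    j * c * c ^ e            ≡⟨ *-assoc j c (c ^ e) ⟩
    j * c ^ suc e            ∎))
    where open ≡-Reasoning

c^z∣b*[x∸1] : ∀ {a b x c z Z} → z ≤ Z → a + b ≡ c ^ z → a + b * x ≡ c ^ Z → c ^ z ∣ b * (x ∸ 1)
c^z∣b*[x∸1] {a} {b} {zero} {c} {z} _ _ _ = subst (c ^ z ∣_) (sym (*-zeroʳ b)) ((c ^ z) ∣0)
c^z∣b*[x∸1] {a} {b} {suc x'} {c} {z} {Z} z≤Z a+b≡c^z a+bx≡c^Z =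
  ∣m+n∣m⇒∣n (subst (c ^ z ∣_) (sym sum≡) (m∣m*n (c ^ (Z ∸ z)))) ∣-refl
  where
  open ≡-Reasoning
  sum≡ : c ^ z + b * x' ≡ c ^ z * c ^ (Z ∸ z)
  sum≡ = begin
    c ^ z + b * x'       ≡⟨ cong (_+ b * x') a+b≡c^z ⟨
    a + b + b * x'       ≡⟨ +-assoc a b (b * x') ⟩
    a + (b + b * x')     ≡⟨ cong (a +_) (*-suc b x') ⟨
    a + b * suc x'       ≡⟨ a+bx≡c^Z ⟩
    c ^ Z                ≡⟨ cong (c ^_) (m+[n∸m]≡n z≤Z) ⟨
    c ^ (z + (Z ∸ z))    ≡⟨ ^-distribˡ-+-* c z (Z ∸ z) ⟩
    c ^ z * c ^ (Z ∸ z)  ∎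

Y%6≡4⇒N-odd : ∀ {Y N} → Y % 6 ≡ 4 → Y ≡ 1 + 3 * N → ∃[ t ] N ≡ 1 + 2 * t
Y%6≡4⇒N-odd {Y} {N} Y%6≡4 Y≡1+3N = Y / 6 , *-cancelˡ-≡ N (1 + 2 * (Y / 6)) 3 (begin
  3 * N                  ≡⟨ cong (_∸ 1) Y≡1+3N ⟨
  Y ∸ 1                  ≡⟨ cong (_∸ 1) (m≡m%n+[m/n]*n Y 6) ⟩
  Y % 6 + Y / 6 * 6 ∸ 1  ≡⟨ cong (λ r → r + Y / 6 * 6 ∸ 1) Y%6≡4 ⟩
  3 + Y / 6 * 6          ≡⟨ regroup (Y / 6) ⟩
  3 * (1 + 2 * (Y / 6))  ∎)
  where
  open ≡-Reasoning
  regroup : ∀ t → 3 + t * 6 ≡ 3 * (1 + 2 * t)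
  regroup = solve-∀

^-cancelʳ-< : ∀ {c m n} → 1 < c → c ^ m < c ^ n → m < n
^-cancelʳ-< {suc c} {m} {n} 1<c c^m<c^n = ≰⇒> (λ n≤m → <⇒≱ c^m<c^n (^-monoʳ-≤ (suc c) n≤m))

power-bound : ∀ {b c k Y Z} → 4 ≤ c → 2 ≤ b → 4 ≤ Y →
              c ^ k ≤ 1 + b + b * b → b ^ Y < c ^ Z → k + k ≤ Z
power-bound {b@(suc (suc u))} {c} {k} {Y} {Z} 4≤c (s≤s (s≤s z≤n)) 4≤Y c^k≤ b^Y<c^Z =
  s≤s⁻¹ (^-cancelʳ-< (≤-trans (s≤s (s≤s z≤n)) 4≤c) (begin-strict
    c ^ (k + k)                    ≡⟨ ^-distribˡ-+-* c k k ⟩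
    c ^ k * c ^ k                  ≤⟨ *-mono-≤ c^k≤2b² c^k≤2b² ⟩
    (2 * (b * b)) * (2 * (b * b))  ≡⟨ square b ⟩
    4 * b ^ 4                      ≤⟨ *-monoˡ-≤ (b ^ 4) 4≤c ⟩
    c * b ^ 4                      ≤⟨ *-monoʳ-≤ c (^-monoʳ-≤ b 4≤Y) ⟩
    c * b ^ Y                      <⟨ *-monoʳ-< c b^Y<c^Z ⟩
    c * c ^ Z                      ∎))
  where
  open ≤-Reasoning
  instance _ = >-nonZero (≤-trans (s≤s z≤n) 4≤c)
  square : ∀ b → (2 * (b * b)) * (2 * (b * b)) ≡ 4 * (b * (b * (b * (b * 1))))
  square = solve-∀
  excess : ∀ u → 2 * ((2 + u) * (2 + u)) ≡ 1 + (2 + u) + (2 + u) * (2 + u) + (u * u + 3 * u + 1)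
  excess = solve-∀
  c^k≤2b² : c ^ k ≤ 2 * (b * b)
  c^k≤2b² = ≤-trans c^k≤ (subst (1 + b + b * b ≤_) (sym (excess u)) (m≤m+n _ _))

double-bound : ∀ z e {Z} → (z ∸ e) + (z ∸ e) ≤ Z → 2 * z ≤ Z + 2 * e
double-bound z e {Z} k+k≤Z = begin
  2 * z                      ≤⟨ *-monoʳ-≤ 2 (m≤n+m∸n z e) ⟩
  2 * (e + (z ∸ e))          ≡⟨ regroup (z ∸ e) e ⟩
  (z ∸ e) + (z ∸ e) + 2 * e  ≤⟨ +-monoˡ-≤ (2 * e) k+k≤Z ⟩
  Z + 2 * e                  ∎
  where
  open ≤-Reasoning
  regroup : ∀ k e → 2 * (e + k) ≡ k + k + 2 * e
  regroup = solve-∀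

module OddPrime (q : ℕ) (c-prime : Prime (1 + 2 * q)) where

  c : ℕ
  c = 1 + 2 * q

  geom-odd-prime : ∀ {d} → c ∣ d → ∃[ u ] geom d c ≡ c * (1 + c * u)
  geom-odd-prime {.(d' * c)} (divides d' refl) with geom-expansion (d' * c) c
  ... | k , eq = d' * q + d' * d' * k , (begin
    geom (d' * c) c                                   ≡⟨ eq ⟩
    c + d' * c * triangle c + d' * c * (d' * c) * k   ≡⟨ cong (λ t → c + d' * c * t + d' * c * (d' * c) * k)
                                                             (triangle-odd q) ⟩
    c + d' * c * (q * c) + d' * c * (d' * c) * k      ≡⟨ factor c d' q k ⟩
    c * (1 + c * (d' * q + d' * d' * k))              ∎)
    where
    open ≡-Reasoning
    factor : ∀ c d' q k → c + d' * c * (q * c) + d' * c * (d' * c) * k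
                        ≡ c * (1 + c * (d' * q + d' * d' * k))
    factor = solve-∀

  lte-prime : ∀ {d} → c ∣ d → ∀ k → c ^ suc k ∣ (1 + d) ^ c ∸ 1 → c ^ k ∣ d
  lte-prime {d} c∣d k c^[1+k]∣ with geom-odd-prime c∣d
  ... | u , geom≡ = prime-power-divisor c-prime c∤1+cu k
        (*-cancelˡ-∣ c (subst (c ^ suc k ∣_) regrouped c^[1+k]∣))
    where
    instance _ = prime⇒nonZero c-prime
    c∤1+cu : ¬ c ∣ 1 + c * u
    c∤1+cu c∣ = prime∤1 c-prime (∣m+n∣m⇒∣n (subst (c ∣_) (+-comm 1 (c * u)) c∣) (m∣m*n u))
    regrouped : (1 + d) ^ c ∸ 1 ≡ c * ((1 + c * u) * d)
    regrouped = begin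
      (1 + d) ^ c ∸ 1          ≡⟨ suc^∸1≡*geom d c ⟩
      d * geom d c             ≡⟨ cong (d *_) geom≡ ⟩
      d * (c * (1 + c * u))    ≡⟨ swap d c (1 + c * u) ⟩
      c * ((1 + c * u) * d)    ∎
      where
      open ≡-Reasoning
      swap : ∀ d c v → d * (c * v) ≡ c * (v * d)
      swap = solve-∀

  lte-prime-power : ∀ {d} → c ∣ d → ∀ e k → c ^ k ∣ (1 + d) ^ (c ^ e) ∸ 1 → c ^ (k ∸ e) ∣ d
  lte-prime-power {d} c∣d zero    k       c^k∣ =
    subst (c ^ k ∣_) (cong (_∸ 1) (*-identityʳ (1 + d))) c^k∣
  lte-prime-power {d} c∣d (suc e) zero    _    = 1∣ d
  lte-prime-power {d} c∣d (suc e) (suc k) c^[1+k]∣ =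
    lte-prime-power c∣d e k (subst (c ^ k ∣_) (sym (suc^∸1≡*geom d (c ^ e))) c^k∣d₁)
    where
    c^k∣d₁ : c ^ k ∣ d * geom d (c ^ e)
    c^k∣d₁ = lte-prime (∣m⇒∣m*n (geom d (c ^ e)) c∣d) k
      (subst (λ x → c ^ suc k ∣ x ∸ 1) (suc^[m*n]≡suc-geom^m d c (c ^ e)) c^[1+k]∣)

  lte : ∀ {d m} → c ∣ d → ¬ c ∣ m → ∀ e k → c ^ k ∣ (1 + d) ^ (m * c ^ e) ∸ 1 → c ^ (k ∸ e) ∣ d
  lte {d} {m} c∣d c∤m e k c^k∣ =
    lte-prime-power c∣d e k (subst (c ^ k ∣_) (sym (suc^∸1≡*geom d (c ^ e))) c^k∣d₁)
    where
    c^k∣d₁ : c ^ k ∣ d * geom d (c ^ e)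
    c^k∣d₁ = lte-coprime c-prime (∣m⇒∣m*n (geom d (c ^ e)) c∣d) c∤m k
      (subst (λ x → c ^ k ∣ x ∸ 1) (suc^[m*n]≡suc-geom^m d m (c ^ e)) c^k∣)

  b²+b+1-valuation : ∀ {b N m e z} → 1 ≤ b → ¬ b % c ≡ 1 % c → b ^ 3 % c ≡ 1 % c →
                     N ≡ m * c ^ e → ¬ c ∣ m → c ^ z ∣ b ^ (3 * N) ∸ 1 → c ^ (z ∸ e) ∣ 1 + b + b * b
  b²+b+1-valuation {b@(suc _)} {m = m} {e} {z} 1≤b b≢1 b³≡1 refl c∤m c^z∣ =
    prime-power-divisor c-prime (b≢1 ∘ ∣∸1⇒%≡1% 1≤b) (z ∸ e)
      (subst (c ^ (z ∸ e) ∣_) (cube∸1 b)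
        (lte (%≡1%⇒∣∸1 {b ^ 3} b³≡1) c∤m e z
          (subst (λ x → c ^ z ∣ x ∸ 1) (sym (^-*-assoc b 3 (m * c ^ e))) c^z∣)))

2*x*3+1≡1+2*[x*3] : ∀ x → 2 * x * 3 + 1 ≡ 1 + 2 * (x * 3)
2*x*3+1≡1+2*[x*3] = solve-∀

lemma5p10 : (c r a b z Y Z N e : ℕ) →
    Prime c → 1 ≤ r → c ≡ 2 ^ r * 3 + 1 →
    1 < a → 1 < b →
    Coprime a b → Coprime a c → Coprime b c →
    IsEOrder (c ∸ 1) a 3 → IsEOrder (c ∸ 1) b 3 →
    1 ≤ z → 1 ≤ Y → 1 ≤ Z → z ≤ Z →
    Y % 6 ≡ 4 →
    a + b ≡ c ^ z → a + b ^ Y ≡ c ^ Z →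
    Y ≡ 1 + 3 * N → IsVal c N e →
    2 * z ≤ Z + 2 * e
lemma5p10 c (suc r) a b z Y Z N e c-prime _ c≡ 1<a 1<b _ _ b⊥c _ b-order@(_ , b³≡±1 , _)
          1≤z _ _ z≤Z Y%6≡4 a+b≡c^z a+b^Y≡c^Z Y≡1+3N νN
  -- suc (c ∸ 1), the modulus in IsEOrder (c ∸ 1), only reduces to c once c is visibly a successor
  with refl ← trans c≡ (2*x*3+1≡1+2*[x*3] (2 ^ r)) | refl ← Y≡1+3N
  with t , N≡1+2t ← Y%6≡4⇒N-odd {N = N} Y%6≡4 refl
  with m , N≡mc^e , c∤m ← IsVal⇒cofactor {c} {N} {e} νN =
  double-bound z e
    (power-bound {k = z ∸ e} {Z = Z} 4≤c 1<b 4≤Y (∣⇒≤ (c^[z∸e]∣b²+b+1 b³≡±1)) b^Y<c^Z)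
  where
  open OddPrime (2 ^ r * 3) c-prime hiding (c)
  4≤c : 4 ≤ c
  4≤c = s≤s (≤-trans (m≤m+n 3 3) (*-monoʳ-≤ 2 (*-monoˡ-≤ 3 (m^n>0 2 r))))
  4≤Y : 4 ≤ 1 + 3 * N
  4≤Y = s≤s (*-monoʳ-≤ 3 (subst (1 ≤_) (sym N≡1+2t) (s≤s z≤n)))
  b^Y<c^Z : b ^ (1 + 3 * N) < c ^ Z
  b^Y<c^Z = subst (b ^ (1 + 3 * N) <_) a+b^Y≡c^Z (m<n+m (b ^ (1 + 3 * N)) (<⇒≤ 1<a))
  c^z∣b^[3N]∸1 : c ^ z ∣ b ^ (3 * N) ∸ 1
  c^z∣b^[3N]∸1 = prime-power-divisor c-prime (prime∤coprime c-prime b⊥c) z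
                   (c^z∣b*[x∸1] {a} {b} {b ^ (3 * N)} z≤Z a+b≡c^z a+b^Y≡c^Z)
  c^[z∸e]∣b²+b+1 : PlusMinusOne (c ∸ 1) (b ^ 3) → c ^ (z ∸ e) ∣ 1 + b + b * b
  c^[z∸e]∣b²+b+1 (inj₁ b³≡1) =
    b²+b+1-valuation {e = e} {z} (<⇒≤ 1<b) (IsEOrder⇒≢1 (s≤s (s≤s z≤n)) b-order)
      b³≡1 N≡mc^e c∤m c^z∣b^[3N]∸1
  c^[z∸e]∣b²+b+1 (inj₂ b³≡-1) = contradiction
    (subst (λ n → c ∣ b ^ (3 * n) ∸ 1) N≡1+2t (∣-trans (m∣m^n 1≤z) c^z∣b^[3N]∸1))
    (subst (λ x → ¬ c ∣ x ∸ 1) (^-*-assoc b 3 (1 + 2 * t))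
      (∣+1⇒∤^odd∸1 {x = b ^ 3} t (≤-trans (s≤s (s≤s (s≤s z≤n))) 4≤c) (%≡pred⇒∣+1 b³≡-1)))
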